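{- There is a positive constant $c$ such that the following holds for every finite (left) quasifield $Q$ with $q$ elements and every $A \subset Q\setminus\{0\}$. If $q^{1/2} \ll |A| < q^{2/3}$, then \[ \max\{|A+A|, |A\cdot A|\} \geq c\,\frac{|A|^2}{q^{1/2}}. \] If $q^{2/3} \leq |A| \ll q$, then \[ \max\{|A+A|, |A\cdot A|\} \geq c\,(q|A|)^{1/2}. \]
   Context: A (left) quasifield is a set $Q$ with two binary operations $+$ and $\cdot$ such that $(Q,+)$ is a group with identity $0$; $(Q\setminus\{0\},\cdot)$ is a loop (for all $a,b$ the equations $a\cdot x=b$ and $y\cdot a=b$ have unique solutions, and there is an identity $1$); $a\cdot(b+c)=a\cdot b+a\cdot c$ for all $a,b,c$; $0\cdot x=0$ for all $x$; and for $a\neq b$ the equation $a\cdot x=b\cdot x+c$ has exactly one solution $x$. For $A\subset Q$, $A+A=\{a+b: a,b\in A\}$ and $A\cdot A=\{a\cdot b: a,b\in A\}$. The notation $f \ll g$ means $f = o(g)$ (as $q\to\infty$). -}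

module Defs where

open import Data.Nat using (ℕ; _⊔_)
open import Data.Fin using (Fin; _≟_)
open import Data.Fin.Properties using (any?)
open import Data.Fin.Subset using (Subset; _∈_; _∉_; ∣_∣; inside; outside)
open import Data.Fin.Subset.Properties using (_∈?_)
open import Data.Vec using (tabulate)
open import Data.Product using (Σ; _×_; _,_; ∃)
open import Relation.Nullary using (¬_; does)
open import Relation.Nullary.Decidable using (_×-dec_)
open import Relation.Binary.PropositionalEquality using (_≡_; _≢_)
open import Data.Bool using (if_then_else_)

∃!≢ : ∀ {q} → Fin q → (Fin q → Set) → Set
∃!≢ {q} z P = Σ (Fin q) λ x → (x ≢ z) × P x × (∀ y → y ≢ z → P y → y ≡ x)

∃! : ∀ {q} → (Fin q → Set) → Set
∃! {q} P = Σ (Fin q) λ x → P x × (∀ y → P y → y ≡ x)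

record Quasifield (q : ℕ) : Set where
  field
    _+_  : Fin q → Fin q → Fin q
    _·_  : Fin q → Fin q → Fin q
    0#   : Fin q
    1#   : Fin q
    -_   : Fin q → Fin q
    +-assoc    : ∀ a b c → (a + b) + c ≡ a + (b + c)
    +-identityˡ : ∀ a → 0# + a ≡ a
    +-identityʳ : ∀ a → a + 0# ≡ a
    +-inverseˡ : ∀ a → (- a) + a ≡ 0#
    +-inverseʳ : ∀ a → a + (- a) ≡ 0#
    1≢0        : 1# ≢ 0#
    ·-closed   : ∀ a b → a ≢ 0# → b ≢ 0# → (a · b) ≢ 0#
    ·-identityˡ : ∀ a → a ≢ 0# → 1# · a ≡ a
    ·-identityʳ : ∀ a → a ≢ 0# → a · 1# ≡ a
    ·-divˡ     : ∀ a b → a ≢ 0# → b ≢ 0# → ∃!≢ 0# (λ x → a · x ≡ b)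
    ·-divʳ     : ∀ a b → a ≢ 0# → b ≢ 0# → ∃!≢ 0# (λ y → y · a ≡ b)
    ·-distribˡ : ∀ a b c → a · (b + c) ≡ (a · b) + (a · c)
    ·-zeroˡ    : ∀ x → 0# · x ≡ 0#
    planar     : ∀ a b c → a ≢ b → ∃! (λ x → a · x ≡ (b · x) + c)

module _ {q : ℕ} (Q : Quasifield q) where
  open Quasifield Q

  imageSet : (Fin q → Fin q → Fin q) → Subset q → Subset q
  imageSet _∘_ A = tabulate λ z →
    if does (any? λ a → any? λ b → (a ∈? A) ×-dec ((b ∈? A) ×-dec ((a ∘ b) ≟ z)))
    then inside else outside

  sumset : Subset q → Subset q
  sumset = imageSet _+_

  prodset : Subset q → Subset q
  prodset = imageSet _·_

  maxSP : Subset q → ℕ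
  maxSP A = ∣ sumset A ∣ ⊔ ∣ prodset A ∣

{-# OPTIONS --safe #-}
module Submission where

open import Defs
open import Data.Nat using (ℕ; suc; _*_; _^_; _≤_; _<_)
open import Data.Fin.Subset using (Subset; _∉_; ∣_∣)
open import Data.Product using (Σ; _×_)

open import Level using (0ℓ)
open import Algebra.Bundles using (Group)
import Algebra.Properties.Group as GroupProperties
open import Data.Bool using (true; false; if_then_else_)
open import Data.Fin using (Fin; zero; suc)
open import Data.Fin.Permutation using (permutation)
open import Data.Fin.Properties using (_≟_; suc-injective; 0≢1+n; any?)
open import Data.Fin.Subset using (_∈_; inside; outside)
open import Data.Fin.Subset.Properties using (_∈?_)
open import Data.Nat using (zero; _+_; _∸_; ∣_-_∣; _⊔_; z≤n; s≤s)
open import Data.Nat.Properties hiding (_≟_; suc-injective; 0≢1+n)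
open import Data.Nat.Tactic.RingSolver using (solve-∀)
open import Algebra.Properties.Semiring.Sum +-*-semiring
  using ( sum; sum-syntax; sum-cong-≗; sum-replicate-zero; sum-permute
        ; ∑-comm; ∑-distrib-+; *-distribˡ-sum; *-distribʳ-sum )
open import Data.Product using (_,_)
open import Data.Sum using (_⊎_; inj₁; inj₂; [_,_]′)
open import Data.Vec using (_∷_; []; lookup)
open import Data.Vec.Properties using (lookup∘tabulate; []=⇒lookup; lookup⇒[]=)
open import Function using (_∘_; Injective)
open import Relation.Binary.PropositionalEquality
open import Relation.Nullary using (yes; no; does; contradiction)
open import Relation.Nullary.Decidable using (dec-true; dec-false; _×-dec_)

-- Put S = A + A, T = A · A, P = |S| |T|, and count the points of S × T on
-- each of the q² lines y = c + m · x.  Every line carries P / q points on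
-- average, and since right multiplication by a nonzero element is injective,
-- two points with distinct abscissae lie on at most one common line; hence
-- the incidence counts have variance at most P / q.  But each of the |A|²
-- lines y = −(m · b) + m · x with m, b ∈ A contains the |A| points
-- (b + z, m · z), z ∈ A.  Comparing the two gives q |A| ≤ 2P or
-- |A|⁴ ≤ 4qP, from which both regimes of the corollary follow with c = 1/2.

sum-mono-≤ : ∀ {n} {f g : Fin n → ℕ} → (∀ i → f i ≤ g i) → sum f ≤ sum g
sum-mono-≤ {zero}  f≤g = z≤n
sum-mono-≤ {suc n} f≤g = +-mono-≤ (f≤g zero) (sum-mono-≤ (f≤g ∘ suc))

sum-const : ∀ n c → ∑[ i < n ] c ≡ n * c
sum-const zero    c = refl
sum-const (suc n) c = cong (c +_) (sum-const n c)

sum-*-sum : ∀ {m n} (f : Fin m → ℕ) (g : Fin n → ℕ) →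
  sum f * sum g ≡ ∑[ i < m ] ∑[ j < n ] (f i * g j)
sum-*-sum f g = trans (*-distribʳ-sum (sum g) f) (sum-cong-≗ λ i → *-distribˡ-sum (f i) g)

δ : ∀ {n} → Fin n → Fin n → ℕ
δ i j = if does (i ≟ j) then 1 else 0

δ-≢ : ∀ {n} {i j : Fin n} → i ≢ j → δ i j ≡ 0
δ-≢ {i = i} {j} i≢j = cong (if_then 1 else 0) (dec-false (i ≟ j) i≢j)

sum-δ-* : ∀ {n} (i : Fin n) (g : Fin n → ℕ) → ∑[ j < n ] (δ i j * g j) ≡ g i
sum-δ-* {suc n} zero    g =
  trans (cong₂ _+_ (+-identityʳ (g zero)) (sum-replicate-zero n)) (+-identityʳ (g zero))
sum-δ-* {suc n} (suc i) g = sum-δ-* i (g ∘ suc)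

sum-δ-injective-≤1 : ∀ {m n} (h : Fin m → Fin n) → Injective _≡_ _≡_ h →
  ∀ j → ∑[ i < m ] δ (h i) j ≤ 1
sum-δ-injective-≤1 {zero}  h inj j = z≤n
sum-δ-injective-≤1 {suc m} h inj j with h zero ≟ j
... | no _     = sum-δ-injective-≤1 (h ∘ suc) (λ e → suc-injective (inj e)) j
... | yes h₀≡j = s≤s (≤-reflexive (trans (sum-cong-≗ δᵢ≡0) (sum-replicate-zero m)))
  where
  δᵢ≡0 : ∀ i → δ (h (suc i)) j ≡ 0
  δᵢ≡0 i = δ-≢ λ hᵢ≡j → 0≢1+n (inj (trans h₀≡j (sym hᵢ≡j)))

sum-∘-injective-≤ : ∀ {m n} (h : Fin m → Fin n) → Injective _≡_ _≡_ h →
  (g : Fin n → ℕ) → ∑[ i < m ] g (h i) ≤ sum g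
sum-∘-injective-≤ {m} {n} h inj g = begin
  ∑[ i < m ] g (h i)                      ≡⟨ sum-cong-≗ (λ i → sum-δ-* (h i) g) ⟨
  ∑[ i < m ] ∑[ j < n ] (δ (h i) j * g j)  ≡⟨ ∑-comm (λ i j → δ (h i) j * g j) ⟩
  ∑[ j < n ] ∑[ i < m ] (δ (h i) j * g j)  ≡⟨ sum-cong-≗ (λ j → *-distribʳ-sum (g j) (λ i → δ (h i) j)) ⟨
  ∑[ j < n ] (∑[ i < m ] δ (h i) j * g j)  ≤⟨ sum-mono-≤ (λ j → *-monoˡ-≤ (g j) (sum-δ-injective-≤1 h inj j)) ⟩
  ∑[ j < n ] (1 * g j)                    ≡⟨ sum-cong-≗ (λ j → *-identityˡ (g j)) ⟩
  sum g                                   ∎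
  where open ≤-Reasoning

sum-∘-inverse : ∀ {n} (h h⁻¹ : Fin n → Fin n) →
  (∀ j → h (h⁻¹ j) ≡ j) → (∀ i → h⁻¹ (h i) ≡ i) →
  (g : Fin n → ℕ) → ∑[ i < n ] g (h i) ≡ sum g
sum-∘-inverse h h⁻¹ inverseˡ inverseʳ g =
  sym (sum-permute g (permutation h h⁻¹ inverseˡ inverseʳ))

χ : ∀ {n} → Subset n → Fin n → ℕ
χ A i = if lookup A i then 1 else 0

∣p∣≡sum-χ : ∀ {n} (A : Subset n) → ∣ A ∣ ≡ sum (χ A)
∣p∣≡sum-χ []          = refl
∣p∣≡sum-χ (true  ∷ A) = cong suc (∣p∣≡sum-χ A)
∣p∣≡sum-χ (false ∷ A) = ∣p∣≡sum-χ A

∣p∣*m≡∑χ*m : ∀ {n} (A : Subset n) m → ∣ A ∣ * m ≡ ∑[ i < n ] (χ A i * m)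
∣p∣*m≡∑χ*m A m = trans (cong (_* m) (∣p∣≡sum-χ A)) (*-distribʳ-sum m (χ A))

χ*χ≡χ : ∀ {n} (A : Subset n) i → χ A i * χ A i ≡ χ A i
χ*χ≡χ A i with lookup A i
... | true  = refl
... | false = refl

χ-*-≤ : ∀ {n} (A : Subset n) i {m k} → (i ∈ A → m ≤ k) → χ A i * m ≤ k
χ-*-≤ A i {m} imp with lookup A i in eq
... | true  = ≤-trans (≤-reflexive (*-identityˡ m)) (imp (lookup⇒[]= i A eq))
... | false = z≤n

χ≤χ : ∀ {n} {A B : Subset n} {i j} → (i ∈ A → j ∈ B) → χ A i ≤ χ B j
χ≤χ {A = A} {B} {i} {j} imp with lookup A i in eq
... | true rewrite []=⇒lookup (imp (lookup⇒[]= i A eq)) = ≤-refl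
... | false = z≤n

∑∑ : ∀ {n} → (Fin n → Fin n → ℕ) → ℕ
∑∑ {n} f = ∑[ i < n ] ∑[ j < n ] f i j

∑∑-cong : ∀ {n} {f g : Fin n → Fin n → ℕ} → (∀ i j → f i j ≡ g i j) → ∑∑ f ≡ ∑∑ g
∑∑-cong f≡g = sum-cong-≗ λ i → sum-cong-≗ (f≡g i)

∑∑-mono-≤ : ∀ {n} {f g : Fin n → Fin n → ℕ} → (∀ i j → f i j ≤ g i j) → ∑∑ f ≤ ∑∑ g
∑∑-mono-≤ f≤g = sum-mono-≤ λ i → sum-mono-≤ (f≤g i)

∑∑-comm : ∀ {n} (f : Fin n → Fin n → Fin n → Fin n → ℕ) →
  ∑∑ (λ i j → ∑∑ (f i j)) ≡ ∑∑ (λ k l → ∑∑ (λ i j → f i j k l))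
∑∑-comm {n} f = begin
  ∑[ i < n ] ∑[ j < n ] ∑[ k < n ] ∑[ l < n ] f i j k l
    ≡⟨ sum-cong-≗ (λ i → ∑-comm (λ j k → ∑[ l < n ] f i j k l)) ⟩
  ∑[ i < n ] ∑[ k < n ] ∑[ j < n ] ∑[ l < n ] f i j k l
    ≡⟨ sum-cong-≗ (λ i → sum-cong-≗ (λ k → ∑-comm (λ j l → f i j k l))) ⟩
  ∑[ i < n ] ∑[ k < n ] ∑[ l < n ] ∑[ j < n ] f i j k l
    ≡⟨ ∑-comm (λ i k → ∑[ l < n ] ∑[ j < n ] f i j k l) ⟩
  ∑[ k < n ] ∑[ i < n ] ∑[ l < n ] ∑[ j < n ] f i j k l
    ≡⟨ sum-cong-≗ (λ k → ∑-comm (λ i l → ∑[ j < n ] f i j k l)) ⟩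
  ∑[ k < n ] ∑[ l < n ] ∑[ i < n ] ∑[ j < n ] f i j k l
    ∎
  where open ≡-Reasoning

∑∑-distrib-+ : ∀ {n} (f g : Fin n → Fin n → ℕ) →
  ∑∑ (λ i j → f i j + g i j) ≡ ∑∑ f + ∑∑ g
∑∑-distrib-+ f g =
  trans (sum-cong-≗ λ i → ∑-distrib-+ (f i) (g i)) (∑-distrib-+ (sum ∘ f) (sum ∘ g))

*-distribˡ-∑∑ : ∀ {n} k (f : Fin n → Fin n → ℕ) → k * ∑∑ f ≡ ∑∑ (λ i j → k * f i j)
*-distribˡ-∑∑ k f =
  trans (*-distribˡ-sum k (sum ∘ f)) (sum-cong-≗ λ i → *-distribˡ-sum k (f i))

∑∑-const : ∀ n k → ∑∑ {n} (λ _ _ → k) ≡ n * (n * k)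
∑∑-const n k = trans (sum-cong-≗ {n} λ _ → sum-const n k) (sum-const n (n * k))

sum-pairs-δ : ∀ {n} (w : Fin n → ℕ) K L →
  ∑∑ (λ x x′ → w x * w x′ * (δ x x′ * K + L))
    ≡ ∑[ x < n ] (w x * w x * K) + L * (sum w * sum w)
sum-pairs-δ {n} w K L = begin
  ∑∑ (λ x x′ → w x * w x′ * (δ x x′ * K + L))
    ≡⟨ ∑∑-cong (λ x x′ → split (w x) (w x′) (δ x x′) K L) ⟩
  ∑∑ (λ x x′ → δ x x′ * (w x * w x′ * K) + L * (w x * w x′))
    ≡⟨ ∑∑-distrib-+ (λ x x′ → δ x x′ * (w x * w x′ * K)) _ ⟩
  ∑∑ (λ x x′ → δ x x′ * (w x * w x′ * K)) + ∑∑ (λ x x′ → L * (w x * w x′))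
    ≡⟨ cong₂ _+_ (sum-cong-≗ λ x → sum-δ-* x (λ x′ → w x * w x′ * K)) pairs ⟩
  ∑[ x < n ] (w x * w x * K) + L * (sum w * sum w)
    ∎
  where
  open ≡-Reasoning
  split : ∀ a b d K L → a * b * (d * K + L) ≡ d * (a * b * K) + L * (a * b)
  split = solve-∀
  pairs : ∑∑ (λ x x′ → L * (w x * w x′)) ≡ L * (sum w * sum w)
  pairs = sym (trans (cong (L *_) (sum-*-sum w w)) (*-distribˡ-∑∑ L (λ x x′ → w x * w x′)))

∣m-n∣²+2mn≡m²+n² : ∀ m n → ∣ m - n ∣ * ∣ m - n ∣ + 2 * m * n ≡ m * m + n * n
∣m-n∣²+2mn≡m²+n² m n = [ ordered , flipped ]′ (≤-total m n)
  where
  expand : ∀ m k → k * k + 2 * m * (m + k) ≡ m * m + (m + k) * (m + k)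
  expand = solve-∀
  ordered : ∀ {m n} → m ≤ n → ∣ m - n ∣ * ∣ m - n ∣ + 2 * m * n ≡ m * m + n * n
  ordered {m} m≤n with m≤n⇒∃[o]m+o≡n m≤n
  ... | k , refl = trans (cong (λ d → d * d + 2 * m * (m + k)) (∣m-m+n∣≡n m k)) (expand m k)
  swap : ∀ m n → 2 * n * m ≡ 2 * m * n
  swap = solve-∀
  flipped : n ≤ m → ∣ m - n ∣ * ∣ m - n ∣ + 2 * m * n ≡ m * m + n * n
  flipped n≤m = begin
    ∣ m - n ∣ * ∣ m - n ∣ + 2 * m * n  ≡⟨ cong₂ (λ d e → d * d + e) (∣-∣-comm m n) (swap n m) ⟩
    ∣ n - m ∣ * ∣ n - m ∣ + 2 * n * m  ≡⟨ ordered n≤m ⟩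
    n * n + m * m                      ≡⟨ +-comm (n * n) (m * m) ⟩
    m * m + n * n                      ∎
    where open ≡-Reasoning

-- r has mean at least P / q and second moment at most P / q + (P / q)²,
-- hence variance at most P / q.
deviation-bound : ∀ q P (r : Fin q → Fin q → ℕ) → q * P ≤ ∑∑ r →
  ∑∑ (λ i j → r i j * r i j) ≤ q * P + P * P →
  ∑∑ (λ i j → ∣ q * r i j - P ∣ * ∣ q * r i j - P ∣) ≤ q * q * q * P
deviation-bound q P r mean second =
  +-cancelʳ-≤ (2 * q * P * (q * P)) D (q * q * q * P) (begin
    D + 2 * q * P * (q * P)                     ≤⟨ +-monoʳ-≤ D (*-monoʳ-≤ (2 * q * P) mean) ⟩
    D + 2 * q * P * ∑∑ r                        ≡⟨ expansion ⟩
    q * q * R₂ + q * (q * (P * P))              ≤⟨ +-monoˡ-≤ _ (*-monoʳ-≤ (q * q) second) ⟩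
    q * q * (q * P + P * P) + q * (q * (P * P)) ≡⟨ collect q P ⟩
    q * q * q * P + 2 * q * P * (q * P)         ∎)
  where
  open ≤-Reasoning
  dev : ℕ → ℕ
  dev x = ∣ q * x - P ∣ * ∣ q * x - P ∣
  D = ∑∑ (λ i j → dev (r i j))
  R₂ = ∑∑ (λ i j → r i j * r i j)
  reassoc : ∀ q P x → 2 * q * P * x ≡ 2 * (q * x) * P
  reassoc = solve-∀
  square : ∀ q x P → q * x * (q * x) + P * P ≡ q * q * (x * x) + P * P
  square = solve-∀
  collect : ∀ q P →
    q * q * (q * P + P * P) + q * (q * (P * P)) ≡ q * q * q * P + 2 * q * P * (q * P)
  collect = solve-∀
  pointwise : ∀ x → dev x + 2 * q * P * x ≡ q * q * (x * x) + P * P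
  pointwise x = trans (cong (dev x +_) (reassoc q P x))
                      (trans (∣m-n∣²+2mn≡m²+n² (q * x) P) (square q x P))
  expansion : D + 2 * q * P * ∑∑ r ≡ q * q * R₂ + q * (q * (P * P))
  expansion = begin-equality
    D + 2 * q * P * ∑∑ r
      ≡⟨ cong (D +_) (*-distribˡ-∑∑ (2 * q * P) r) ⟩
    D + ∑∑ (λ i j → 2 * q * P * r i j)
      ≡⟨ ∑∑-distrib-+ (λ i j → dev (r i j)) _ ⟨
    ∑∑ (λ i j → dev (r i j) + 2 * q * P * r i j)
      ≡⟨ ∑∑-cong (λ i j → pointwise (r i j)) ⟩
    ∑∑ (λ i j → q * q * (r i j * r i j) + P * P)
      ≡⟨ ∑∑-distrib-+ (λ i j → q * q * (r i j * r i j)) (λ _ _ → P * P) ⟩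
    ∑∑ (λ i j → q * q * (r i j * r i j)) + ∑∑ {q} (λ _ _ → P * P)
      ≡⟨ cong₂ _+_ (*-distribˡ-∑∑ (q * q) (λ i j → r i j * r i j)) (sym (∑∑-const q (P * P))) ⟨
    q * q * R₂ + q * (q * (P * P))
      ∎

unique-nonzero-preimage⇒injective : ∀ {q} {z : Fin q} (f : Fin q → Fin q) → f z ≡ z →
  (∀ x → x ≢ z → f x ≢ z) → (∀ b → b ≢ z → ∃!≢ z (λ x → f x ≡ b)) → Injective _≡_ _≡_ f
unique-nonzero-preimage⇒injective {z = z} f fz≡z f-nonzero preimage {x} {y} fx≡fy
  with x ≟ z | y ≟ z
... | yes x≡z | yes y≡z = trans x≡z (sym y≡z)
... | yes x≡z | no  y≢z = contradiction (trans (sym fx≡fy) (trans (cong f x≡z) fz≡z)) (f-nonzero y y≢z)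
... | no  x≢z | yes y≡z = contradiction (trans fx≡fy (trans (cong f y≡z) fz≡z)) (f-nonzero x x≢z)
... | no  x≢z | no  y≢z with preimage (f x) (f-nonzero x x≢z)
...   | _ , _ , _ , unique = trans (unique x x≢z refl) (sym (unique y y≢z (sym fx≡fy)))

module QuasifieldProperties {q : ℕ} (Q : Quasifield q) where
  open Quasifield Q using (0#; ·-closed; ·-divˡ; ·-divʳ; ·-distribˡ; ·-zeroˡ)
    renaming ( _+_ to infixl 6 _⊕_ ; _·_ to infixl 7 _⊙_ ; -_ to ⊖_
             ; +-assoc to ⊕-assoc ; +-identityˡ to ⊕-identityˡ ; +-identityʳ to ⊕-identityʳ
             ; +-inverseˡ to ⊕-inverseˡ ; +-inverseʳ to ⊕-inverseʳ )

  ⊕-group : Group 0ℓ 0ℓ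
  ⊕-group = record
    { Carrier = Fin q ; _≈_ = _≡_ ; _∙_ = _⊕_ ; ε = 0# ; _⁻¹ = ⊖_
    ; isGroup = record
      { isMonoid = record
        { isSemigroup = record
          { isMagma = record { isEquivalence = isEquivalence ; ∙-cong = cong₂ _⊕_ }
          ; assoc = ⊕-assoc }
        ; identity = ⊕-identityˡ , ⊕-identityʳ }
      ; inverse = ⊕-inverseˡ , ⊕-inverseʳ
      ; ⁻¹-cong = cong ⊖_ } }

  open GroupProperties ⊕-group public
    using ( ∙-cancelˡ; ⁻¹-injective
          ; \\-leftDividesˡ; \\-leftDividesʳ; //-rightDividesˡ; //-rightDividesʳ )

  ·-zeroʳ : ∀ a → a ⊙ 0# ≡ 0#
  ·-zeroʳ a = sym (∙-cancelˡ (a ⊙ 0#) 0# (a ⊙ 0#) (begin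
    a ⊙ 0# ⊕ 0#      ≡⟨ ⊕-identityʳ (a ⊙ 0#) ⟩
    a ⊙ 0#           ≡⟨ cong (a ⊙_) (⊕-identityˡ 0#) ⟨
    a ⊙ (0# ⊕ 0#)    ≡⟨ ·-distribˡ a 0# 0# ⟩
    a ⊙ 0# ⊕ a ⊙ 0#  ∎))
    where open ≡-Reasoning

  ·-injectiveˡ : ∀ {a} → a ≢ 0# → Injective _≡_ _≡_ (a ⊙_)
  ·-injectiveˡ {a} a≢0 = unique-nonzero-preimage⇒injective (a ⊙_) (·-zeroʳ a)
    (λ x → ·-closed a x a≢0) (λ b → ·-divˡ a b a≢0)

  ·-injectiveʳ : ∀ {d} → d ≢ 0# → Injective _≡_ _≡_ (_⊙ d)
  ·-injectiveʳ {d} d≢0 = unique-nonzero-preimage⇒injective (_⊙ d) (·-zeroˡ d)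
    (λ x x≢0 → ·-closed x d x≢0 d≢0) (λ b → ·-divʳ d b d≢0)

  ⊖ab⊕a[b⊕c]≡ac : ∀ a b c → ⊖ (a ⊙ b) ⊕ a ⊙ (b ⊕ c) ≡ a ⊙ c
  ⊖ab⊕a[b⊕c]≡ac a b c =
    trans (cong (⊖ (a ⊙ b) ⊕_) (·-distribˡ a b c)) (\\-leftDividesʳ (a ⊙ b) (a ⊙ c))

  y⊖ax⊕ax′≡y⊕a[⊖x⊕x′] : ∀ y a x x′ → y ⊕ ⊖ (a ⊙ x) ⊕ a ⊙ x′ ≡ y ⊕ a ⊙ (⊖ x ⊕ x′)
  y⊖ax⊕ax′≡y⊕a[⊖x⊕x′] y a x x′ = begin
    y ⊕ ⊖ (a ⊙ x) ⊕ a ⊙ x′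
      ≡⟨ cong (λ w → y ⊕ ⊖ (a ⊙ x) ⊕ a ⊙ w) (\\-leftDividesˡ x x′) ⟨
    y ⊕ ⊖ (a ⊙ x) ⊕ a ⊙ (x ⊕ (⊖ x ⊕ x′))
      ≡⟨ cong (y ⊕ ⊖ (a ⊙ x) ⊕_) (·-distribˡ a x (⊖ x ⊕ x′)) ⟩
    y ⊕ ⊖ (a ⊙ x) ⊕ (a ⊙ x ⊕ a ⊙ (⊖ x ⊕ x′))
      ≡⟨ ⊕-assoc _ _ _ ⟨
    y ⊕ ⊖ (a ⊙ x) ⊕ a ⊙ x ⊕ a ⊙ (⊖ x ⊕ x′)
      ≡⟨ cong (_⊕ a ⊙ (⊖ x ⊕ x′)) (//-rightDividesˡ (a ⊙ x) y) ⟩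
    y ⊕ a ⊙ (⊖ x ⊕ x′)
      ∎
    where open ≡-Reasoning

  ⊖x⊕x′≢0 : ∀ {x x′} → x ≢ x′ → ⊖ x ⊕ x′ ≢ 0#
  ⊖x⊕x′≢0 {x} {x′} x≢x′ d≡0 = x≢x′ (begin
    x               ≡⟨ ⊕-identityʳ x ⟨
    x ⊕ 0#          ≡⟨ cong (x ⊕_) d≡0 ⟨
    x ⊕ (⊖ x ⊕ x′)  ≡⟨ \\-leftDividesˡ x x′ ⟩
    x′              ∎)
    where open ≡-Reasoning

  sum-⊕ʳ : ∀ t (f : Fin q → ℕ) → ∑[ x < q ] f (x ⊕ t) ≡ sum f
  sum-⊕ʳ t = sum-∘-inverse (_⊕ t) (_⊕ ⊖ t) (//-rightDividesˡ t) (//-rightDividesʳ t)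

  sum-⊕ˡ : ∀ t (f : Fin q → ℕ) → ∑[ x < q ] f (t ⊕ x) ≡ sum f
  sum-⊕ˡ t = sum-∘-inverse (t ⊕_) (⊖ t ⊕_) (\\-leftDividesˡ t) (\\-leftDividesʳ t)

  ∈-imageSet : ∀ (_∘_ : Fin q → Fin q → Fin q) {A a b} → a ∈ A → b ∈ A → a ∘ b ∈ imageSet Q _∘_ A
  ∈-imageSet _∘_ {A} {a} {b} a∈A b∈A = lookup⇒[]= (a ∘ b) (imageSet Q _∘_ A)
    (trans (lookup∘tabulate _ (a ∘ b))
      (cong (if_then inside else outside)
        (dec-true (any? λ u → any? λ v → (u ∈? A) ×-dec ((v ∈? A) ×-dec ((u ∘ v) ≟ (a ∘ b))))
                  (a , b , a∈A , b∈A , refl))))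

module Incidences {q : ℕ} (Q : Quasifield q) (A : Subset q) where
  open Quasifield Q using (0#) renaming (_+_ to infixl 6 _⊕_ ; _·_ to infixl 7 _⊙_ ; -_ to ⊖_)
  open QuasifieldProperties Q

  S T : Subset q
  S = sumset Q A
  T = prodset Q A

  P : ℕ
  P = ∣ S ∣ * ∣ T ∣

  -- (m, c) stands for the line y = c + m · x.
  incidences : Fin q → Fin q → ℕ
  incidences m c = ∑[ x < q ] (χ S x * χ T (c ⊕ m ⊙ x))

  ∑∑-incidences : ∑∑ incidences ≡ q * P
  ∑∑-incidences = begin
    ∑∑ incidences
      ≡⟨ sum-cong-≗ (λ m → ∑-comm (λ c x → χ S x * χ T (c ⊕ m ⊙ x))) ⟩
    ∑[ m < q ] ∑[ x < q ] ∑[ c < q ] (χ S x * χ T (c ⊕ m ⊙ x))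
      ≡⟨ sum-cong-≗ (λ m → sum-cong-≗ λ x → *-distribˡ-sum (χ S x) (λ c → χ T (c ⊕ m ⊙ x))) ⟨
    ∑[ m < q ] ∑[ x < q ] (χ S x * ∑[ c < q ] χ T (c ⊕ m ⊙ x))
      ≡⟨ sum-cong-≗ (λ m → sum-cong-≗ λ x → cong (χ S x *_) (sum-χT-line m x)) ⟩
    ∑[ m < q ] ∑[ x < q ] (χ S x * ∣ T ∣)
      ≡⟨ sum-cong-≗ {q} (λ _ → ∣p∣*m≡∑χ*m S ∣ T ∣) ⟨
    ∑[ m < q ] P
      ≡⟨ sum-const q P ⟩
    q * P
      ∎
    where
    open ≡-Reasoning
    sum-χT-line : ∀ m x → ∑[ c < q ] χ T (c ⊕ m ⊙ x) ≡ ∣ T ∣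
    sum-χT-line m x = trans (sum-⊕ʳ (m ⊙ x) (χ T)) (sym (∣p∣≡sum-χ T))

  collinear : Fin q → Fin q → ℕ
  collinear x x′ = ∑∑ (λ m c → χ T (c ⊕ m ⊙ x) * χ T (c ⊕ m ⊙ x′))

  collinear-diagonal : ∀ x → collinear x x ≡ q * ∣ T ∣
  collinear-diagonal x = begin
    ∑∑ (λ m c → χ T (c ⊕ m ⊙ x) * χ T (c ⊕ m ⊙ x))
      ≡⟨ ∑∑-cong (λ m c → χ*χ≡χ T (c ⊕ m ⊙ x)) ⟩
    ∑[ m < q ] ∑[ c < q ] χ T (c ⊕ m ⊙ x)
      ≡⟨ sum-cong-≗ (λ m → trans (sum-⊕ʳ (m ⊙ x) (χ T)) (sym (∣p∣≡sum-χ T))) ⟩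
    ∑[ m < q ] ∣ T ∣
      ≡⟨ sum-const q ∣ T ∣ ⟩
    q * ∣ T ∣
      ∎
    where open ≡-Reasoning

  collinear-off-diagonal : ∀ {x x′} → x ≢ x′ → collinear x x′ ≤ ∣ T ∣ * ∣ T ∣
  collinear-off-diagonal {x} {x′} x≢x′ = begin
    ∑∑ (λ m c → χ T (c ⊕ m ⊙ x) * χ T (c ⊕ m ⊙ x′))
      ≡⟨ sum-cong-≗ (λ m → sum-⊕ʳ (⊖ (m ⊙ x)) _) ⟨
    ∑∑ (λ m y → χ T (y ⊕ ⊖ (m ⊙ x) ⊕ m ⊙ x) * χ T (y ⊕ ⊖ (m ⊙ x) ⊕ m ⊙ x′))
      ≡⟨ ∑∑-cong (λ m y → cong₂ (λ u v → χ T u * χ T v)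
                     (//-rightDividesˡ (m ⊙ x) y) (y⊖ax⊕ax′≡y⊕a[⊖x⊕x′] y m x x′)) ⟩
    ∑∑ (λ m y → χ T y * χ T (y ⊕ m ⊙ d))
      ≡⟨ ∑-comm (λ m y → χ T y * χ T (y ⊕ m ⊙ d)) ⟩
    ∑[ y < q ] ∑[ m < q ] (χ T y * χ T (y ⊕ m ⊙ d))
      ≡⟨ sum-cong-≗ (λ y → *-distribˡ-sum (χ T y) (λ m → χ T (y ⊕ m ⊙ d))) ⟨
    ∑[ y < q ] (χ T y * ∑[ m < q ] χ T (y ⊕ m ⊙ d))
      ≤⟨ sum-mono-≤ (λ y → *-monoʳ-≤ (χ T y) (sum-χT-≤ y)) ⟩
    ∑[ y < q ] (χ T y * ∣ T ∣)
      ≡⟨ ∣p∣*m≡∑χ*m T ∣ T ∣ ⟨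
    ∣ T ∣ * ∣ T ∣
      ∎
    where
    open ≤-Reasoning
    d = ⊖ x ⊕ x′
    sum-χT-≤ : ∀ y → ∑[ m < q ] χ T (y ⊕ m ⊙ d) ≤ ∣ T ∣
    sum-χT-≤ y = begin
      ∑[ m < q ] χ T (y ⊕ m ⊙ d)
        ≤⟨ sum-∘-injective-≤ (_⊙ d) (·-injectiveʳ (⊖x⊕x′≢0 x≢x′)) (λ z → χ T (y ⊕ z)) ⟩
      ∑[ z < q ] χ T (y ⊕ z)  ≡⟨ sum-⊕ˡ y (χ T) ⟩
      sum (χ T)               ≡⟨ ∣p∣≡sum-χ T ⟨
      ∣ T ∣                   ∎

  collinear-≤ : ∀ x x′ → collinear x x′ ≤ δ x x′ * (q * ∣ T ∣) + ∣ T ∣ * ∣ T ∣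
  collinear-≤ x x′ with x ≟ x′
  ... | yes refl = ≤-trans (≤-reflexive (trans (collinear-diagonal x) (sym (*-identityˡ _)))) (m≤m+n _ _)
  ... | no x≢x′  = collinear-off-diagonal x≢x′

  ∑∑-incidences² : ∑∑ (λ m c → incidences m c * incidences m c) ≤ q * P + P * P
  ∑∑-incidences² = begin
    ∑∑ (λ m c → incidences m c * incidences m c)
      ≡⟨ ∑∑-cong (λ m c → sum-*-sum (point m c) (point m c)) ⟩
    ∑∑ (λ m c → ∑∑ (λ x x′ → point m c x * point m c x′))
      ≡⟨ ∑∑-comm (λ m c x x′ → point m c x * point m c x′) ⟩
    ∑∑ (λ x x′ → ∑∑ (λ m c → point m c x * point m c x′))
      ≡⟨ ∑∑-cong factor ⟩
    ∑∑ (λ x x′ → χ S x * χ S x′ * collinear x x′)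
      ≤⟨ ∑∑-mono-≤ (λ x x′ → *-monoʳ-≤ (χ S x * χ S x′) (collinear-≤ x x′)) ⟩
    ∑∑ (λ x x′ → χ S x * χ S x′ * (δ x x′ * K + L))
      ≡⟨ sum-pairs-δ (χ S) K L ⟩
    ∑[ x < q ] (χ S x * χ S x * K) + L * (sum (χ S) * sum (χ S))
      ≡⟨ cong₂ _+_ (sum-cong-≗ λ x → cong (_* K) (χ*χ≡χ S x))
                   (cong (λ s → L * (s * s)) (sym (∣p∣≡sum-χ S))) ⟩
    ∑[ x < q ] (χ S x * K) + L * (∣ S ∣ * ∣ S ∣)
      ≡⟨ cong (_+ L * (∣ S ∣ * ∣ S ∣)) (∣p∣*m≡∑χ*m S K) ⟨
    ∣ S ∣ * K + L * (∣ S ∣ * ∣ S ∣)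
      ≡⟨ regroup q ∣ S ∣ ∣ T ∣ ⟩
    q * P + P * P
      ∎
    where
    open ≤-Reasoning
    K = q * ∣ T ∣
    L = ∣ T ∣ * ∣ T ∣
    point : Fin q → Fin q → Fin q → ℕ
    point m c x = χ S x * χ T (c ⊕ m ⊙ x)
    interchange : ∀ a b c d → a * b * (c * d) ≡ a * c * (b * d)
    interchange = solve-∀
    factor : ∀ x x′ → ∑∑ (λ m c → point m c x * point m c x′) ≡ χ S x * χ S x′ * collinear x x′
    factor x x′ = trans
      (∑∑-cong (λ m c → interchange (χ S x) (χ T (c ⊕ m ⊙ x)) (χ S x′) (χ T (c ⊕ m ⊙ x′))))
      (sym (*-distribˡ-∑∑ (χ S x * χ S x′) (λ m c → χ T (c ⊕ m ⊙ x) * χ T (c ⊕ m ⊙ x′))))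
    regroup : ∀ q s t → s * (q * t) + t * t * (s * s) ≡ q * (s * t) + s * t * (s * t)
    regroup = solve-∀

  incidences-rich : ∀ {a b} → a ∈ A → b ∈ A → ∣ A ∣ ≤ incidences a (⊖ (a ⊙ b))
  incidences-rich {a} {b} a∈A b∈A = begin
    ∣ A ∣                    ≡⟨ ∣p∣≡sum-χ A ⟩
    sum (χ A)                ≤⟨ sum-mono-≤ point ⟩
    ∑[ z < q ] on-line (b ⊕ z) ≡⟨ sum-⊕ˡ b on-line ⟩
    incidences a (⊖ (a ⊙ b)) ∎
    where
    open ≤-Reasoning
    on-line : Fin q → ℕ
    on-line x = χ S x * χ T (⊖ (a ⊙ b) ⊕ a ⊙ x)
    point : ∀ z → χ A z ≤ on-line (b ⊕ z)
    point z = subst (_≤ on-line (b ⊕ z)) (χ*χ≡χ A z) (*-mono-≤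
      (χ≤χ (∈-imageSet _⊕_ b∈A))
      (χ≤χ λ z∈A → subst (_∈ T) (sym (⊖ab⊕a[b⊕c]≡ac a b z)) (∈-imageSet _⊙_ a∈A z∈A)))

  deviation : Fin q → Fin q → ℕ
  deviation m c = ∣ q * incidences m c - P ∣ * ∣ q * incidences m c - P ∣

  rich-lines-deviation : 0# ∉ A →
    ∣ A ∣ * ∣ A ∣ * ((q * ∣ A ∣ ∸ P) * (q * ∣ A ∣ ∸ P)) ≤ ∑∑ deviation
  rich-lines-deviation 0∉A = begin
    ∣ A ∣ * ∣ A ∣ * (X * X)                 ≡⟨ *-assoc ∣ A ∣ ∣ A ∣ (X * X) ⟩
    ∣ A ∣ * (∣ A ∣ * (X * X))               ≡⟨ ∣p∣*m≡∑χ*m A (∣ A ∣ * (X * X)) ⟩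
    ∑[ m < q ] (χ A m * (∣ A ∣ * (X * X)))  ≤⟨ sum-mono-≤ (λ m → χ-*-≤ A m row) ⟩
    ∑∑ deviation                            ∎
    where
    open ≤-Reasoning
    X = q * ∣ A ∣ ∸ P
    row : ∀ {m} → m ∈ A → ∣ A ∣ * (X * X) ≤ ∑[ c < q ] deviation m c
    row {m} m∈A = begin
      ∣ A ∣ * (X * X)
        ≡⟨ ∣p∣*m≡∑χ*m A (X * X) ⟩
      ∑[ b < q ] (χ A b * (X * X))
        ≤⟨ sum-mono-≤ (λ b → χ-*-≤ A b λ b∈A → *-mono-≤ (excess b∈A) (excess b∈A)) ⟩
      ∑[ b < q ] deviation m (⊖ (m ⊙ b))
        ≤⟨ sum-∘-injective-≤ (λ b → ⊖ (m ⊙ b)) (·-injectiveˡ m≢0 ∘ ⁻¹-injective) (deviation m) ⟩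
      ∑[ c < q ] deviation m c
        ∎
      where
      m≢0 : m ≢ 0#
      m≢0 m≡0 = 0∉A (subst (_∈ A) m≡0 m∈A)
      excess : ∀ {b} → b ∈ A → X ≤ ∣ q * incidences m (⊖ (m ⊙ b)) - P ∣
      excess b∈A = ≤-trans (∸-monoˡ-≤ P (*-monoʳ-≤ q (incidences-rich m∈A b∈A))) (m∸n≤∣m-n∣ _ P)

  key-inequality : 0# ∉ A → ∣ A ∣ * ∣ A ∣ * ((q * ∣ A ∣ ∸ P) * (q * ∣ A ∣ ∸ P)) ≤ q * q * q * P
  key-inequality 0∉A = ≤-trans (rich-lines-deviation 0∉A)
    (deviation-bound q P incidences (≤-reflexive (sym ∑∑-incidences)) ∑∑-incidences²)

n≤2*[n∸m] : ∀ {m n} → 2 * m ≤ n → n ≤ 2 * (n ∸ m)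
n≤2*[n∸m] {m} {n} 2m≤n = begin
  n                  ≡⟨ m+[n∸m]≡n m≤n ⟨
  m + (n ∸ m)        ≤⟨ +-monoˡ-≤ (n ∸ m) m≤n∸m ⟩
  (n ∸ m) + (n ∸ m)  ≡⟨ cong ((n ∸ m) +_) (+-identityʳ (n ∸ m)) ⟨
  2 * (n ∸ m)        ∎
  where
  open ≤-Reasoning
  m+m≤n : m + m ≤ n
  m+m≤n = subst (_≤ n) (cong (m +_) (+-identityʳ m)) 2m≤n
  m≤n : m ≤ n
  m≤n = m+n≤o⇒m≤o m m+m≤n
  m≤n∸m : m ≤ n ∸ m
  m≤n∸m = subst (_≤ n ∸ m) (m+n∸m≡n m m) (∸-monoˡ-≤ m m+m≤n)
excess-dichotomy : ∀ q a P → a * a * ((q * a ∸ P) * (q * a ∸ P)) ≤ q * q * q * P →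
  q * a ≤ 2 * P ⊎ a ^ 4 ≤ 4 * (P * q)
excess-dichotomy zero      a P _   = inj₁ z≤n
excess-dichotomy q@(suc _) a P key =
  [ inj₁ , (λ 2P<qa → inj₂ (fourth-power (<⇒≤ 2P<qa))) ]′ (≤-<-connex (q * a) (2 * P))
  where
  X = q * a ∸ P
  e₁ : ∀ q a → q * q * (a * (a * (a * (a * 1)))) ≡ a * a * (q * a * (q * a))
  e₁ = solve-∀
  e₂ : ∀ a X → a * a * (2 * X * (2 * X)) ≡ 4 * (a * a * (X * X))
  e₂ = solve-∀
  e₃ : ∀ q P → 4 * (q * q * q * P) ≡ q * q * (4 * (P * q))
  e₃ = solve-∀
  fourth-power : 2 * P ≤ q * a → a ^ 4 ≤ 4 * (P * q)
  fourth-power 2P≤qa = *-cancelˡ-≤ (q * q) (begin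
    q * q * a ^ 4             ≡⟨ e₁ q a ⟩
    a * a * (q * a * (q * a)) ≤⟨ *-monoʳ-≤ (a * a) (*-mono-≤ qa≤2X qa≤2X) ⟩
    a * a * (2 * X * (2 * X)) ≡⟨ e₂ a X ⟩
    4 * (a * a * (X * X))     ≤⟨ *-monoʳ-≤ 4 key ⟩
    4 * (q * q * q * P)       ≡⟨ e₃ q P ⟩
    q * q * (4 * (P * q))     ∎)
    where
    open ≤-Reasoning
    qa≤2X : q * a ≤ 2 * X
    qa≤2X = n≤2*[n∸m] {P} 2P≤qa

small-regime : ∀ q a P → q * a ≤ 2 * P ⊎ a ^ 4 ≤ 4 * (P * q) → a ^ 3 < q ^ 2 → a ^ 4 ≤ 4 * (P * q)
small-regime q a P (inj₂ a⁴≤4Pq) _     = a⁴≤4Pq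
small-regime q a P (inj₁ qa≤2P)  a³<q² = begin
  a ^ 4         ≤⟨ *-monoʳ-≤ a (<⇒≤ a³<q²) ⟩
  a * q ^ 2     ≡⟨ e₁ a q ⟩
  q * (q * a)   ≤⟨ *-monoʳ-≤ q qa≤2P ⟩
  q * (2 * P)   ≤⟨ *-monoʳ-≤ q (*-monoˡ-≤ P (s≤s (s≤s (z≤n {2})))) ⟩
  q * (4 * P)   ≡⟨ e₂ q P ⟩
  4 * (P * q)   ∎
  where
  open ≤-Reasoning
  e₁ : ∀ a q → a * (q * (q * 1)) ≡ q * (q * a)
  e₁ = solve-∀
  e₂ : ∀ q P → q * (4 * P) ≡ 4 * (P * q)
  e₂ = solve-∀

large-regime : ∀ q a P → q * a ≤ 2 * P ⊎ a ^ 4 ≤ 4 * (P * q) → q ^ 2 ≤ a ^ 3 → q * a ≤ 4 * P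
large-regime q         a P (inj₁ qa≤2P)  _     = ≤-trans qa≤2P (*-monoˡ-≤ P (s≤s (s≤s (z≤n {2}))))
large-regime zero      a P (inj₂ _)      _     = z≤n
large-regime q@(suc _) a P (inj₂ a⁴≤4Pq) q²≤a³ = *-cancelˡ-≤ q (begin
  q * (q * a)    ≡⟨ e₁ q a ⟩
  q ^ 2 * a      ≤⟨ *-monoˡ-≤ a q²≤a³ ⟩
  a ^ 3 * a      ≡⟨ e₂ a ⟩
  a ^ 4          ≤⟨ a⁴≤4Pq ⟩
  4 * (P * q)    ≡⟨ e₃ q P ⟩
  q * (4 * P)    ∎)
  where
  open ≤-Reasoning
  e₁ : ∀ q a → q * (q * a) ≡ q * (q * 1) * a
  e₁ = solve-∀
  e₂ : ∀ a → a * (a * (a * 1)) * a ≡ a * (a * (a * (a * 1)))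
  e₂ = solve-∀
  e₃ : ∀ q P → 4 * (P * q) ≡ q * (4 * P)
  e₃ = solve-∀

m*n≤[m⊔n]^2 : ∀ m n → m * n ≤ (m ⊔ n) ^ 2
m*n≤[m⊔n]^2 m n =
  *-mono-≤ (m≤m⊔n m n) (≤-trans (m≤n⊔m m n) (≤-reflexive (sym (*-identityʳ (m ⊔ n)))))

corollary1p5 : Σ ℕ λ k → Σ ℕ λ m →
    ∀ (q : ℕ) (Q : Quasifield q) (A : Subset q) → Quasifield.0# Q ∉ A →
      ((suc m ^ 2 * q ≤ ∣ A ∣ ^ 2 → ∣ A ∣ ^ 3 < q ^ 2 →
          ∣ A ∣ ^ 4 ≤ suc k ^ 2 * (maxSP Q A ^ 2 * q))
      × (q ^ 2 ≤ ∣ A ∣ ^ 3 → suc m * ∣ A ∣ ≤ q →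
          q * ∣ A ∣ ≤ suc k ^ 2 * maxSP Q A ^ 2))
-- The bounds hold without the o(·) hypotheses, which are therefore ignored
-- (m = 0); k = 1 gives c = 1/2.
corollary1p5 = 1 , 0 , λ q Q A 0∉A →
  let open Incidences Q A
      dichotomy = excess-dichotomy q ∣ A ∣ P (key-inequality 0∉A)
      P≤maxSP² = m*n≤[m⊔n]^2 ∣ S ∣ ∣ T ∣
  in (λ _ a³<q² → ≤-trans (small-regime q ∣ A ∣ P dichotomy a³<q²)
                          (*-monoʳ-≤ 4 (*-monoˡ-≤ q P≤maxSP²)))
   , (λ q²≤a³ _ → ≤-trans (large-regime q ∣ A ∣ P dichotomy q²≤a³)
                          (*-monoʳ-≤ 4 P≤maxSP²))
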